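{- Let $(G,v)$ be a based graph, regarded as a digraph, and let $k\ge 2$. Let $f\colon I_f\to G$ and $g\colon I_g\to G$ be paths with $I_f,I_g\in\mathcal{J}_n$, both starting and ending at $v$, such that $f(i)=g(i)$ for every $i=0,1,\dots,n$. Then $f\approx_k g$.
   Context: A digraph $X$ is a set $V(X)$ with $E(X)\subset V(X)^2\setminus\{(x,x)\}$; a graph is a digraph with symmetric $E$. A digraph map $f\colon X\to Y$ is a function on vertices with $(x,y)\in E(X)\Rightarrow (f(x),f(y))\in E(Y)$ or $f(x)=f(y)$. $\mathcal{J}_0$ consists of the digraph with the single vertex $0$; for $n\ge1$, $\mathcal{J}_n$ is the set of digraphs on $\{0,\dots,n\}$ having, for each $i=0,\dots,n-1$, exactly one of the edges $(i,i+1)$, $(i+1,i)$, and no other edges. A path of length $n$ in $X$ is a digraph map $I_n\to X$ with $I_n\in\mathcal{J}_n$. For paths $f\colon I_m\to X$, $g\colon I_n\to X$ with $f(m)=g(0)$, the concatenation $f\cdot g\colon I_m+I_n\to X$ is defined on the obvious concatenated domain in $\mathcal{J}_{m+n}$ by $f\cdot g(i)=f(i)$ for $i\le m$, $g(i-m)$ for $i\ge m$. For $k\ge1$, $\Gamma_k$ is the digraph with vertices $u_0=v_0,u_1,v_1,\dots,u_{k-1},v_{k-1},u_k=v_k$ and edges $(u_i,u_{i+1}),(v_i,v_{i+1})$ for $i=0,\dots,k-1$; $\Gamma_0$ is a single vertex. For a vertex $x$ of $\Gamma_s$: if $s=0$, $\rho_x$ is the constant path $I\to\Gamma_0$ with $I\in\mathcal{J}_1$;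 if $s=1$, $\rho_x\colon I_2\to\Gamma_1$ is the unique non-constant path with $\rho_x(0)=\rho_x(2)=x$; if $s\ge2$, $\rho_x\colon I_{2s}\to\Gamma_s$ is the path of length $2s$ with $\rho_x(0)=\rho_x(2s)=x$ that traverses the underlying $2s$-cycle of $\Gamma_s$ once without backtracking in a fixed (clockwise) orientation. For a based digraph $(X,x_0)$ let $\vec\Omega(X,x_0)$ be the set of paths starting and ending at $x_0$. Write $f\to_k g$ if $f=g$, or if $f=f_1\cdot f_2$ and $g=f_1\cdot(h\circ\rho_x)\cdot f_2$ where $f_1,f_2$ are paths, $h\colon\Gamma_s\to X$ is a digraph map with $s\in\{0,k\}$, and $x$ is a vertex of $\Gamma_s$ with $h(x)$ the terminal point of $f_1$. Then $\approx_k$ is the smallest equivalence relation on $\vec\Omega(X,x_0)$ containing $\to_k$. -}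

module Defs where

open import Data.Nat using (ℕ; zero; suc; _+_; _<_; _≤_; _<ᵇ_; _%_)
open import Data.Nat.DivMod using (_mod_)
open import Data.Nat.Properties using (1+n≢n)
open import Data.Fin using (Fin; toℕ)
open import Data.Bool using (Bool; true; false)
open import Data.List using (List; []; _∷_; _++_; map; upTo)
open import Data.Product using (_×_; _,_; proj₁; proj₂)
open import Data.Sum using (_⊎_)
open import Data.Empty using (⊥)
open import Relation.Nullary using (¬_)
open import Relation.Binary.PropositionalEquality using (_≡_; refl; sym; trans)

record Digraph : Set₁ where
  field
    V      : Set
    E      : V → V → Set
    irrefl : ∀ x → ¬ E x x
open Digraph public

IsGraph : Digraph → Set
IsGraph X = ∀ a b → E X a b → E X b a

record DigraphMap (X Y : Digraph) : Set where
  field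
    fun  : V X → V Y
    pres : ∀ a b → E X a b → E Y (fun a) (fun b) ⊎ fun a ≡ fun b
open DigraphMap public

-- A path f : I_n → X with I_n ∈ J_n is encoded by its start
-- vertex f(0) together with the list of n steps; step i (0-based) is
-- (b , f(i+1)) where b = true iff (i,i+1) ∈ E(I_n) and b = false iff
-- (i+1,i) ∈ E(I_n).

Step : Digraph → Set
Step X = Bool × V X

Adm : (X : Digraph) → Bool → V X → V X → Set
Adm X true  a c = E X a c ⊎ a ≡ c
Adm X false a c = E X c a ⊎ a ≡ c

data IsPathFrom (X : Digraph) : V X → List (Step X) → Set where
  []  : ∀ {a} → IsPathFrom X a []
  _∷_ : ∀ {a b c st} → Adm X b a c → IsPathFrom X c st →
        IsPathFrom X a ((b , c) ∷ st)

end : (X : Digraph) → V X → List (Step X) → V X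
end X a []             = a
end X a ((_ , c) ∷ st) = end X c st

-- f(i) (junk value for i > n)
vertexAt : (X : Digraph) → V X → List (Step X) → ℕ → V X
vertexAt X a st             zero    = a
vertexAt X a []             (suc i) = a
vertexAt X a ((_ , c) ∷ st) (suc i) = vertexAt X c st i

-- For s = suc t the 2s vertices are numbered by their position
-- on the underlying 2s-cycle: position 0 = u_0 = v_0, position i = u_i
-- (1 ≤ i ≤ s, so position s = u_s = v_s), position 2s - j = v_j
-- (1 ≤ j ≤ s-1).

cyc : ℕ → ℕ
cyc t = suc t + suc t

ΓV : ℕ → Set
ΓV zero    = Fin 1
ΓV (suc t) = Fin (cyc t)

data ΓE (t : ℕ) (i j : Fin (cyc t)) : Set where
  -- (u_i , u_{i+1})
  up    : toℕ i < suc t → toℕ j ≡ suc (toℕ i) → ΓE t i j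
  -- (v_m , v_{m+1}) for 1 ≤ m ≤ s-1 : positions (p+1 , p), s ≤ p
  down  : suc t ≤ toℕ j → toℕ i ≡ suc (toℕ j) → ΓE t i j
  -- (v_0 , v_1) : positions (0 , 2s-1)
  close : toℕ j ≡ suc t + t → toℕ i ≡ 0 → ΓE t i j

ΓEdge : (s : ℕ) → ΓV s → ΓV s → Set
ΓEdge zero    _ _ = ⊥
ΓEdge (suc t) i j = ΓE t i j

ΓIrrefl : (s : ℕ) → ∀ x → ¬ ΓEdge s x x
ΓIrrefl zero    x ()
ΓIrrefl (suc t) x (up _ e)     = 1+n≢n (sym e)
ΓIrrefl (suc t) x (down _ e)   = 1+n≢n (sym e)
ΓIrrefl (suc t) x (close e e') with trans (sym e) e'
... | ()

Γ : ℕ → Digraph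
Γ s = record { V = ΓV s ; E = ΓEdge s ; irrefl = ΓIrrefl s }

-- For s ≥ 1: go once around the cycle in the
-- direction of increasing position (u_0 → u_1 → … → u_s → v_{s-1} → … → v_0),
-- step from position p to p+1 is forward iff p < s.
-- For s = 0 the constant path with I = ({0,1},{(0,1)}) (the other
-- orientation is covered separately by the relation below).
ρ : (s : ℕ) → ΓV s → List (Bool × ΓV s)
ρ zero    x = (true , x) ∷ []
ρ (suc t) x = map stp (upTo (cyc t))
  where
  stp : ℕ → Bool × Fin (cyc t)
  stp i = ((((toℕ x + i) % cyc t) <ᵇ suc t) , (toℕ x + suc i) mod cyc t)

hρ : {X : Digraph} (s : ℕ) → DigraphMap (Γ s) X → ΓV s → List (Step X)
hρ s h x = map (λ p → (proj₁ p , fun h (proj₂ p))) (ρ s x)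

-- The relations →_k and ≈_k on Ω(X,x0).  Elements of Ω(X,x0) are
-- encoded by their step list (start vertex x0).

data Move (k : ℕ) (X : Digraph) (x0 : V X) : List (Step X) → List (Step X) → Set where
  -- s = 0 : insert a constant path of length 1 (either I ∈ J_1)
  ins0 : (s1 s2 : List (Step X)) (b : Bool) →
         IsPathFrom X x0 s1 → IsPathFrom X (end X x0 s1) s2 →
         end X (end X x0 s1) s2 ≡ x0 →
         Move k X x0 (s1 ++ s2) (s1 ++ ((b , end X x0 s1) ∷ s2))
  insk : (s1 s2 : List (Step X)) (h : DigraphMap (Γ k) X) (x : ΓV k) →
         fun h x ≡ end X x0 s1 →
         IsPathFrom X x0 s1 → IsPathFrom X (end X x0 s1) s2 →
         end X (end X x0 s1) s2 ≡ x0 →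
         Move k X x0 (s1 ++ s2) (s1 ++ (hρ k h x ++ s2))

data Approx (k : ℕ) (X : Digraph) (x0 : V X) : List (Step X) → List (Step X) → Set where
  ≈-refl  : ∀ {f} → Approx k X x0 f f
  ≈-sym   : ∀ {f g} → Approx k X x0 f g → Approx k X x0 g f
  ≈-trans : ∀ {f g h} → Approx k X x0 f g → Approx k X x0 g h → Approx k X x0 f h
  ≈-move  : ∀ {f g} → Move k X x0 f g → Approx k X x0 f g

{-# OPTIONS --safe #-}
-- It suffices to reverse the orientation of a single step from a to c, where a
-- and c are adjacent or equal.  Either orientation is ≈ₖ-equivalent to the
-- detour a → c → a ← c.  For the forward step, insert at c the loop h ∘ ρ₀
-- where h : Γₖ → G sends u₀ to c and every other vertex to a; for the backward
-- step, insert at a the loop for the h sending only u₁ to c.  Deleting the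
-- stationary steps of the inserted loop (inverse moves with s = 0) leaves
-- exactly the detour.  The second loop starts with the two forward steps
-- u₀ → u₁ → u₂, which is where k ≥ 2 is used.
module Submission where

open import Defs
open import Data.Nat using (ℕ; _≤_)
open import Data.List using (List; length)
open import Relation.Binary.PropositionalEquality using (_≡_)

open import Data.Bool using (Bool; true; false; not; if_then_else_)
open import Data.Fin using (toℕ; zero)
open import Data.Fin.Properties using (toℕ-fromℕ<)
open import Data.List using ([]; _∷_; _++_; [_]; map; upTo; applyUpTo)
open import Data.List.Properties using (++-assoc; map-++; map-∘; applyUpTo-∷ʳ)
open import Data.List.Relation.Binary.Pointwise using (Pointwise; []; _∷_)
open import Data.List.Relation.Unary.All using (All; []; _∷_)
open import Data.List.Relation.Unary.All.Properties using (map⁺; applyUpTo⁺₁)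
open import Data.Nat using (suc; _+_; _<_; _<ᵇ_; _≡ᵇ_; _%_; z≤n; s≤s)
open import Data.Nat.DivMod using (_mod_; m<n⇒m%n≡m; n%n≡0)
open import Data.Nat.Properties
  using (suc-injective; m≤n⇒m<n∨m≡n; m≤n⇒m≤o+n; n≤1+n; n<1+n)
open import Data.Product using (_,_; proj₂)
open import Data.Sum using (_⊎_; inj₁; inj₂)
open import Function using (_∘_; _on_)
open import Level using (0ℓ)
open import Relation.Binary.Bundles using (Setoid)
open import Relation.Binary.PropositionalEquality
  using (refl; sym; trans; cong; cong₂; subst; subst₂; module ≡-Reasoning)

approxSetoid : ℕ → (X : Digraph) → V X → Setoid 0ℓ 0ℓ
approxSetoid k X v = record
  { Carrier       = List (Step X)
  ; _≈_           = Approx k X v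
  ; isEquivalence = record { refl = ≈-refl ; sym = ≈-sym ; trans = ≈-trans }
  }

module _ {X : Digraph} where

  end-++ : ∀ a (s t : List (Step X)) → end X a (s ++ t) ≡ end X (end X a s) t
  end-++ a []            t = refl
  end-++ a ((_ , c) ∷ s) t = end-++ c s t

  IsPathFrom-++ : ∀ {a} (s : List (Step X)) {t} →
                  IsPathFrom X a s → IsPathFrom X (end X a s) t → IsPathFrom X a (s ++ t)
  IsPathFrom-++ []      []       q = q
  IsPathFrom-++ (_ ∷ s) (e ∷ p)  q = e ∷ IsPathFrom-++ s p q

  adm-stationary : ∀ b {x} → Adm X b x x
  adm-stationary true  = inj₂ refl
  adm-stationary false = inj₂ refl

  adm-flip : ∀ b {x y} → Adm X b x y → Adm X (not b) y x
  adm-flip true  (inj₁ e) = inj₁ e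
  adm-flip false (inj₁ e) = inj₁ e
  adm-flip true  (inj₂ q) = inj₂ (sym q)
  adm-flip false (inj₂ q) = inj₂ (sym q)

  graph-adm : IsGraph X → ∀ {a c} b b′ → Adm X b a c → Adm X b′ a c
  graph-adm sym-E true  true  ad       = ad
  graph-adm sym-E false false ad       = ad
  graph-adm sym-E true  false (inj₁ e) = inj₁ (sym-E _ _ e)
  graph-adm sym-E false true  (inj₁ e) = inj₁ (sym-E _ _ e)
  graph-adm sym-E true  false (inj₂ q) = inj₂ q
  graph-adm sym-E false true  (inj₂ q) = inj₂ q

  data Destutter : V X → List (Step X) → List (Step X) → Set where
    []   : ∀ {x} → Destutter x [] []
    stay : ∀ {x b L L′} → Destutter x L L′ → Destutter x ((b , x) ∷ L) L′
    move : ∀ {x y b L L′} → Destutter y L L′ → Destutter x ((b , y) ∷ L) ((b , y) ∷ L′)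

  destutter-refl : ∀ {x} (L : List (Step X)) → Destutter x L L
  destutter-refl []      = []
  destutter-refl (_ ∷ L) = move (destutter-refl L)

  destutter-++ : ∀ {x L L′} (s : List (Step X)) → Destutter x L L′ → Destutter x (L ++ s) (L′ ++ s)
  destutter-++ s []       = destutter-refl s
  destutter-++ s (stay r) = stay (destutter-++ s r)
  destutter-++ s (move r) = move (destutter-++ s r)

  destutter-stationary : ∀ {x} {S : List (Step X)} → All ((_≡ x) ∘ proj₂) S → Destutter x S []
  destutter-stationary []         = []
  destutter-stationary (refl ∷ p) = stay (destutter-stationary p)

  destutter-end : ∀ {x L L′} → Destutter x L L′ → end X x L ≡ end X x L′
  destutter-end []       = refl
  destutter-end (stay r) = destutter-end r
  destutter-end (move r) = destutter-end r

  destutter-path : ∀ {x L L′} → Destutter x L L′ → IsPathFrom X x L′ → IsPathFrom X x L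
  destutter-path []       []      = []
  destutter-path (stay r) p       = adm-stationary _ ∷ destutter-path r p
  destutter-path (move r) (e ∷ p) = e ∷ destutter-path r p

  ≈-destutter : ∀ {k v x L L′} (s₁ : List (Step X)) → Destutter x L L′ →
                IsPathFrom X v s₁ → end X v s₁ ≡ x →
                IsPathFrom X x L′ → end X x L′ ≡ v →
                Approx k X v (s₁ ++ L) (s₁ ++ L′)
  ≈-destutter s₁ [] _ _ _ _ = ≈-refl
  ≈-destutter s₁ (stay {b = b} {L = L} r) p₁ refl p e =
    ≈-trans (≈-sym (≈-move (ins0 s₁ L b p₁ (destutter-path r p) (trans (destutter-end r) e))))
            (≈-destutter s₁ r p₁ refl p e)
  ≈-destutter {k} {v} s₁ (move {y = y} {b = b} {L = L} {L′ = L′} r) p₁ refl (a ∷ p) e =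
    subst₂ (Approx k X v) (++-assoc s₁ [ (b , y) ] L) (++-assoc s₁ [ (b , y) ] L′)
      (≈-destutter (s₁ ++ [ (b , y) ]) r
        (IsPathFrom-++ s₁ p₁ (a ∷ [])) (end-++ v s₁ [ (b , y) ]) p e)

  ≈-insertLoop : ∀ {k v y L} (s₁ s₂ : List (Step X)) (h : DigraphMap (Γ k) X) (x : ΓV k) →
                 fun h x ≡ y → Destutter y (hρ k h x) L →
                 IsPathFrom X y L → end X y L ≡ y →
                 IsPathFrom X v s₁ → end X v s₁ ≡ y →
                 IsPathFrom X y s₂ → end X y s₂ ≡ v →
                 Approx k X v (s₁ ++ s₂) (s₁ ++ L ++ s₂)
  ≈-insertLoop {v = v} {L = L} s₁ s₂ h x hx r pL eL p₁ refl p₂ e₂ =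
    ≈-trans (≈-move (insk s₁ s₂ h x hx p₁ p₂ e₂))
            (≈-destutter s₁ (destutter-++ s₂ r) p₁ refl
              (IsPathFrom-++ L pL (subst (λ z → IsPathFrom X z s₂) (sym eL) p₂))
              (trans (end-++ (end X v s₁) L s₂) (trans (cong (λ z → end X z s₂) eL) e₂)))

loopStep : ∀ {X} t → DigraphMap (Γ (suc t)) X → ℕ → Step X
loopStep t h i = ((i % cyc t <ᵇ suc t) , fun h (suc i mod cyc t))

hρ-zero : ∀ {X} t (h : DigraphMap (Γ (suc t)) X) → hρ (suc t) h zero ≡ map (loopStep t h) (upTo (cyc t))
hρ-zero t h = sym (map-∘ (upTo (cyc t)))

toℕ-mod-< : ∀ {m n} → m < suc n → toℕ (m mod suc n) ≡ m
toℕ-mod-< m<n = trans (toℕ-fromℕ< _) (m<n⇒m%n≡m m<n)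

toℕ-mod-self : ∀ n → toℕ (suc n mod suc n) ≡ 0
toℕ-mod-self n = trans (toℕ-fromℕ< _) (n%n≡0 (suc n))

n≤m⇒m<ᵇn≡false : ∀ {m n} → n ≤ m → (m <ᵇ n) ≡ false
n≤m⇒m<ᵇn≡false z≤n     = refl
n≤m⇒m<ᵇn≡false (s≤s p) = n≤m⇒m<ᵇn≡false p

toℕ-mod-≤ : ∀ {m n} → m ≤ suc n → toℕ (m mod suc n) ≡ m ⊎ toℕ (m mod suc n) ≡ 0
toℕ-mod-≤ {n = n} m≤n with m≤n⇒m<n∨m≡n m≤n
... | inj₁ m<n  = inj₁ (toℕ-mod-< m<n)
... | inj₂ refl = inj₂ (toℕ-mod-self n)

module TwoPoint {X : Digraph} {a c : V X} (ac : Adm X true a c) (ca : Adm X false a c) where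

  ca′ : Adm X true c a
  ca′ = adm-flip {X = X} false ca

  pick : Bool → V X
  pick b = if b then c else a

  pick-pres : ∀ b b′ → E X (pick b) (pick b′) ⊎ pick b ≡ pick b′
  pick-pres true  true  = inj₂ refl
  pick-pres false false = inj₂ refl
  pick-pres false true  = ac
  pick-pres true  false = ca′

  indicator : ∀ t → ℕ → DigraphMap (Γ (suc t)) X
  indicator t j = record { fun = λ p → pick (toℕ p ≡ᵇ j) ; pres = λ p q _ → pick-pres _ _ }

  module _ (t : ℕ) where
    private
      -- cyc (suc t) reduces to suc (suc M), so the first steps of ρ₀ unfold definitionally
      M : ℕ
      M = t + suc (suc t)

    forwardTwice : Destutter a (hρ (suc (suc t)) (indicator (suc t) 1) zero) ((true , c) ∷ (true , a) ∷ [])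
    forwardTwice = subst (λ L → Destutter {X} a L ((true , c) ∷ (true , a) ∷ [])) (sym steps)
      (move (move (destutter-stationary (map⁺ (applyUpTo⁺₁ _ _ rest)))))
      where
      F : ℕ → Step X
      F = loopStep (suc t) (indicator (suc t) 1)
      isOne : ℕ → V X
      isOne m = pick (m ≡ᵇ 1)
      second : isOne (toℕ (2 mod cyc (suc t))) ≡ a
      second = cong isOne (toℕ-mod-< (s≤s (s≤s (m≤n⇒m≤o+n t (s≤s z≤n)))))
      rest : ∀ {i} → i < M → isOne (toℕ (suc (suc (suc i)) mod cyc (suc t))) ≡ a
      rest i<M with toℕ-mod-≤ (s≤s (s≤s i<M))
      ... | inj₁ e = cong isOne e
      ... | inj₂ e = cong isOne e
      steps : hρ (suc (suc t)) (indicator (suc t) 1) zero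
              ≡ (true , c) ∷ (true , a) ∷ map F (applyUpTo (λ i → suc (suc i)) M)
      steps = trans (hρ-zero (suc t) (indicator (suc t) 1))
                    (cong (λ y → (true , c) ∷ (true , y) ∷ map F (applyUpTo (λ i → suc (suc i)) M)) second)

    forwardThenBack : Destutter c (hρ (suc (suc t)) (indicator (suc t) 0) zero) ((true , a) ∷ (false , c) ∷ [])
    forwardThenBack = subst (λ L → Destutter {X} c L ((true , a) ∷ (false , c) ∷ [])) (sym steps)
      (move (destutter-++ [ (false , c) ] (destutter-stationary (map⁺ (applyUpTo⁺₁ suc M middle)))))
      where
      F : ℕ → Step X
      F = loopStep (suc t) (indicator (suc t) 0)
      isZero : ℕ → V X
      isZero m = pick (m ≡ᵇ 0)
      middle : ∀ {i} → i < M → isZero (toℕ (suc (suc i) mod cyc (suc t))) ≡ a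
      middle i<M = cong isZero (toℕ-mod-< (s≤s (s≤s i<M)))
      closing : F (suc M) ≡ (false , c)
      closing = cong₂ _,_
        (trans (cong (_<ᵇ suc (suc t)) (m<n⇒m%n≡m (n<1+n (suc M))))
               (n≤m⇒m<ᵇn≡false (s≤s (m≤n⇒m≤o+n t (n≤1+n (suc t))))))
        (cong isZero (toℕ-mod-self (suc M)))
      steps : hρ (suc (suc t)) (indicator (suc t) 0) zero ≡ (true , a) ∷ map F (applyUpTo suc M) ++ [ (false , c) ]
      steps = begin
        hρ (suc (suc t)) (indicator (suc t) 0) zero     ≡⟨ hρ-zero (suc t) (indicator (suc t) 0) ⟩
        F 0 ∷ map F (applyUpTo suc (suc M))             ≡⟨ cong (λ is → F 0 ∷ map F is) (sym (applyUpTo-∷ʳ suc M)) ⟩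
        F 0 ∷ map F (applyUpTo suc M ++ [ suc M ])      ≡⟨ cong (F 0 ∷_) (map-++ F (applyUpTo suc M) [ suc M ]) ⟩
        F 0 ∷ map F (applyUpTo suc M) ++ [ F (suc M) ]  ≡⟨ cong (λ s → F 0 ∷ map F (applyUpTo suc M) ++ [ s ]) closing ⟩
        (true , a) ∷ map F (applyUpTo suc M) ++ [ (false , c) ] ∎
        where open ≡-Reasoning

module _ {X : Digraph} where

  ≈-reverse : ∀ t {v c} (s₁ s₂ : List (Step X)) →
              Adm X true (end X v s₁) c → Adm X false (end X v s₁) c →
              IsPathFrom X v s₁ → IsPathFrom X c s₂ → end X c s₂ ≡ v →
              Approx (suc (suc t)) X v (s₁ ++ (true , c) ∷ s₂) (s₁ ++ (false , c) ∷ s₂)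
  ≈-reverse t {v} {c} s₁ s₂ ac ca p₁ p₂ e₂ = begin
    s₁ ++ (true , c) ∷ s₂
      ≡⟨ sym (++-assoc s₁ [ (true , c) ] s₂) ⟩
    (s₁ ++ [ (true , c) ]) ++ s₂
      ≈⟨ ≈-insertLoop (s₁ ++ [ (true , c) ]) s₂ (indicator (suc t) 0) zero refl (forwardThenBack t)
           (ca′ ∷ ca ∷ []) refl (IsPathFrom-++ s₁ p₁ (ac ∷ [])) (end-++ v s₁ [ (true , c) ]) p₂ e₂ ⟩
    (s₁ ++ [ (true , c) ]) ++ (true , a) ∷ (false , c) ∷ s₂
      ≡⟨ ++-assoc s₁ [ (true , c) ] _ ⟩
    s₁ ++ (true , c) ∷ (true , a) ∷ (false , c) ∷ s₂
      ≈⟨ ≈-insertLoop s₁ ((false , c) ∷ s₂) (indicator (suc t) 1) zero refl (forwardTwice t)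
           (ac ∷ ca′ ∷ []) refl p₁ refl (ca ∷ p₂) e₂ ⟨
    s₁ ++ (false , c) ∷ s₂ ∎
    where
    open TwoPoint {X} ac ca
    open import Relation.Binary.Reasoning.Setoid (approxSetoid (suc (suc t)) X v)
    a : V X
    a = end X v s₁

  ≈-redirect : IsGraph X → ∀ t {v c} (s₁ s₂ : List (Step X)) b b′ → Adm X b (end X v s₁) c →
               IsPathFrom X v s₁ → IsPathFrom X c s₂ → end X c s₂ ≡ v →
               Approx (suc (suc t)) X v (s₁ ++ (b , c) ∷ s₂) (s₁ ++ (b′ , c) ∷ s₂)
  ≈-redirect sym-E t s₁ s₂ true  true  _  _  _  _  = ≈-refl
  ≈-redirect sym-E t s₁ s₂ false false _  _  _  _  = ≈-refl
  ≈-redirect sym-E t {v} s₁ s₂ true  false ad p₁ p₂ e₂ =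
    ≈-reverse t {v} s₁ s₂ ad (graph-adm {X = X} sym-E true false ad) p₁ p₂ e₂
  ≈-redirect sym-E t {v} s₁ s₂ false true  ad p₁ p₂ e₂ =
    ≈-sym (≈-reverse t {v} s₁ s₂ (graph-adm {X = X} sym-E false true ad) ad p₁ p₂ e₂)

  ≈-sameVertices : IsGraph X → ∀ t {v x} (s₁ : List (Step X)) {fs gs} →
                   Pointwise (_≡_ on proj₂) fs gs →
                   IsPathFrom X v s₁ → end X v s₁ ≡ x →
                   IsPathFrom X x fs → IsPathFrom X x gs → end X x fs ≡ v →
                   Approx (suc (suc t)) X v (s₁ ++ fs) (s₁ ++ gs)
  ≈-sameVertices sym-E t s₁ [] _ _ _ _ _ = ≈-refl
  ≈-sameVertices sym-E t {v} s₁ {(b , c) ∷ fs} {(b′ , _) ∷ gs} (refl ∷ same) p₁ refl (af ∷ pf) (ag ∷ pg) e =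
    ≈-trans (≈-redirect sym-E t s₁ fs b b′ af p₁ pf e)
      (subst₂ (Approx (suc (suc t)) X v) (++-assoc s₁ [ (b′ , c) ] fs) (++-assoc s₁ [ (b′ , c) ] gs)
        (≈-sameVertices sym-E t (s₁ ++ [ (b′ , c) ]) same
          (IsPathFrom-++ s₁ p₁ (ag ∷ [])) (end-++ v s₁ [ (b′ , c) ]) pf pg e))

  pointwise-vertexAt : ∀ {v} (fs gs : List (Step X)) → length fs ≡ length gs →
                       (∀ i → i ≤ length fs → vertexAt X v fs i ≡ vertexAt X v gs i) →
                       Pointwise (_≡_ on proj₂) fs gs
  pointwise-vertexAt []             []               _  _ = []
  pointwise-vertexAt ((_ , c) ∷ fs) ((_ , c′) ∷ gs) eq H with H 1 (s≤s z≤n)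
  ... | refl = refl ∷ pointwise-vertexAt fs gs (suc-injective eq) (λ i i≤n → H (suc i) (s≤s i≤n))

lemma5p3 : (G : Digraph) → IsGraph G → (v : V G) → (k : ℕ) → 2 ≤ k →
    (n : ℕ) → (fs gs : List (Step G)) →
    length fs ≡ n → length gs ≡ n →
    IsPathFrom G v fs → IsPathFrom G v gs →
    end G v fs ≡ v → end G v gs ≡ v →
    (∀ i → i ≤ n → vertexAt G v fs i ≡ vertexAt G v gs i) →
    Approx k G v fs gs
lemma5p3 G sym-E v (suc (suc t)) (s≤s (s≤s z≤n)) _ fs gs refl lg pf pg ef _ H =
  ≈-sameVertices sym-E t [] (pointwise-vertexAt fs gs (sym lg) H) [] refl pf pg ef
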